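{- Let $G$ be a $3$-regular graph. Then there exists a polynomial $P\in\mathbb{Z}[X,Y]$ such that for all $a,b\in\mathbb{C}$, $$\sum_{\sigma:V(G)\to\{0,1\}}\prod_{\{u,v\}\in E(G)}g_{a,b}(\sigma(u),\sigma(v))=P(ab,\,a^3+b^3),$$ where $g_{a,b}(0,0)=a$, $g_{a,b}(0,1)=g_{a,b}(1,0)=1$, $g_{a,b}(1,1)=b$. -}

module Defs where

open import Level using (Level)
open import Data.Bool using (Bool; true; false; _∧_)
open import Data.Nat using (ℕ; zero; suc; _<ᵇ_)
open import Data.Integer using (ℤ; +_; -[1+_])
open import Data.Fin using (Fin; toℕ)
open import Data.Vec using (Vec; []; _∷_; lookup)
open import Data.List using (List; []; _∷_; [_]; map; _++_; foldr; length; filterᵇ; allFin; concatMap)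
open import Data.Product using (_×_; _,_)
open import Relation.Binary.PropositionalEquality using (_≡_)
open import Algebra.Bundles using (CommutativeRing)

record Graph (n : ℕ) : Set where
  field
    adj    : Fin n → Fin n → Bool
    sym    : ∀ u v → adj u v ≡ adj v u
    irrefl : ∀ v → adj v v ≡ false
open Graph public

degree : ∀ {n} → Graph n → Fin n → ℕ
degree {n} G v = length (filterᵇ (adj G v) (allFin n))

ThreeRegular : ∀ {n} → Graph n → Set
ThreeRegular G = ∀ v → degree G v ≡ 3

-- Each unordered edge {u,v} listed once, as the ordered pair (u , v) with u < v.
edges : ∀ {n} → Graph n → List (Fin n × Fin n)
edges {n} G = concatMap (λ u → map (u ,_) (filterᵇ (λ v → (toℕ u <ᵇ toℕ v) ∧ adj G u v) (allFin n))) (allFin n)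

-- All maps σ : Fin n → {0,1}, encoded as Boolean vectors (false = 0, true = 1).
assignments : (n : ℕ) → List (Vec Bool n)
assignments zero = [ [] ]
assignments (suc n) = map (false ∷_) (assignments n) ++ map (true ∷_) (assignments n)

-- Polynomials in ℤ[X,Y]: finite lists of monomials c·X^i·Y^j, given as (c , i , j).
Poly : Set
Poly = List (ℤ × ℕ × ℕ)

module _ {c ℓ : Level} (R : CommutativeRing c ℓ) where
  open CommutativeRing R

  pow : Carrier → ℕ → Carrier
  pow x zero = 1#
  pow x (suc k) = x * pow x k

  natR : ℕ → Carrier
  natR zero = 0#
  natR (suc k) = 1# + natR k

  intR : ℤ → Carrier
  intR (+ k) = natR k
  intR -[1+ k ] = - natR (suc k)

  evalPoly : Poly → Carrier → Carrier → Carrier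
  evalPoly P x y = foldr (λ { (c , i , j) acc → intR c * pow x i * pow y j + acc }) 0# P

  g : Carrier → Carrier → Bool → Bool → Carrier
  g a b false false = a
  g a b false true  = 1#
  g a b true  false = 1#
  g a b true  true  = b

  partitionFn : ∀ {n} → Graph n → Carrier → Carrier → Carrier
  partitionFn {n} G a b =
    foldr _+_ 0# (map (λ σ → foldr _*_ 1#
      (map (λ { (u , v) → g a b (lookup σ u) (lookup σ v) }) (edges G))) (assignments n))

-- Colour vertices by σ and let m₀ σ, m₁ σ count the edges whose ends are both coloured 0,
-- resp. both 1, so σ contributes a^(m₀ σ) b^(m₁ σ). Counting edge ends in a 3-regular graph
-- gives 3 |σ⁻¹(0)| = 2 m₀ σ + k and 3 |σ⁻¹(1)| = 2 m₁ σ + k, where k counts the bichromatic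
-- edges, so 3 divides 2 (m₀ σ - m₁ σ) and m₀ σ ≡ m₁ σ (mod 3). Complementing σ swaps m₀ and m₁; a
-- complementary pair contributes a^A b^B + a^B b^A = (ab)^min(A,B) (u^j + v^j), with u = a³,
-- v = b³ and 3j = |A - B|, and u^j + v^j is a polynomial in uv = (ab)³ and u + v = a³ + b³
-- by Newton's recursion.
module Submission where

open import Defs hiding (sym)
open import Level using (Level)
open import Algebra.Bundles using (CommutativeMonoid; CommutativeRing)
open import Data.Bool using (Bool; true; false; not; _∧_; if_then_else_)
open import Data.Nat as Nat using (ℕ; zero; suc)
open import Data.Nat.Properties using (+-0-commutativeMonoid)
open import Data.Nat.Divisibility using (_∣_; ∣m+n∣m⇒∣n; m∣m*n)
open import Data.Nat.Tactic.RingSolver using (solve-∀)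
open import Data.Nat.DivMod using (_/_; m*n/n≡m)
import Data.Integer as ℤ
open import Data.Fin using (Fin; toℕ)
open import Data.Fin.Properties using (toℕ-injective)
open import Data.Vec as Vec using (Vec; _∷_; lookup)
open import Data.Vec.Properties using (lookup-map)
open import Data.Sum using (_⊎_; inj₁; inj₂)
open import Data.List using (List; []; _∷_; [_]; map; _++_; foldr; concatMap; length; filterᵇ; allFin)
open import Data.List.Properties using (map-∘)
open import Data.Product using (_×_; _,_; proj₁; proj₂; ∃)
open import Function using (_∘_)
open import Data.Empty using (⊥-elim)
open import Relation.Nullary.Reflects using (ofʸ; ofⁿ)
open import Relation.Binary.PropositionalEquality as ≡ using (_≡_)

private variable
  A B : Set

module ListSum {c ℓ : Level} (M : CommutativeMonoid c ℓ) where
  open CommutativeMonoid M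
  open import Algebra.Properties.CommutativeSemigroup commutativeSemigroup using (interchange)

  sumOf : (A → Carrier) → List A → Carrier
  sumOf f xs = foldr _∙_ ε (map f xs)

  sumOf-cong : {f h : A → Carrier} → (∀ x → f x ≈ h x) → ∀ xs → sumOf f xs ≈ sumOf h xs
  sumOf-cong f≈h []       = refl
  sumOf-cong f≈h (x ∷ xs) = ∙-cong (f≈h x) (sumOf-cong f≈h xs)

  sumOf-map : ∀ (f : B → Carrier) (g : A → B) xs → sumOf f (map g xs) ≡ sumOf (f ∘ g) xs
  sumOf-map f g xs = ≡.cong (foldr _∙_ ε) (≡.sym (map-∘ xs))

  sumOf-++ : ∀ (f : A → Carrier) xs ys → sumOf f (xs ++ ys) ≈ sumOf f xs ∙ sumOf f ys
  sumOf-++ f []       ys = sym (identityˡ _)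
  sumOf-++ f (x ∷ xs) ys = trans (∙-congˡ (sumOf-++ f xs ys)) (sym (assoc _ _ _))

  sumOf-∙ : ∀ (f h : A → Carrier) xs → sumOf (λ x → f x ∙ h x) xs ≈ sumOf f xs ∙ sumOf h xs
  sumOf-∙ f h []       = sym (identityˡ ε)
  sumOf-∙ f h (x ∷ xs) = trans (∙-congˡ (sumOf-∙ f h xs)) (interchange _ _ _ _)

  sumOf-ε : ∀ (xs : List A) → sumOf (λ _ → ε) xs ≈ ε
  sumOf-ε []       = refl
  sumOf-ε (x ∷ xs) = trans (∙-congˡ (sumOf-ε xs)) (identityˡ ε)

  sumOf-swap : ∀ (f : A → B → Carrier) xs ys →
               sumOf (λ x → sumOf (f x) ys) xs ≈ sumOf (λ y → sumOf (λ x → f x y) xs) ys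
  sumOf-swap f []       ys = sym (sumOf-ε ys)
  sumOf-swap f (x ∷ xs) ys =
    trans (∙-congˡ (sumOf-swap f xs ys)) (sym (sumOf-∙ (f x) (λ y → sumOf (λ x → f x y) xs) ys))

  sumOf-concatMap : ∀ (f : B → Carrier) (g : A → List B) xs →
                    sumOf f (concatMap g xs) ≈ sumOf (λ x → sumOf f (g x)) xs
  sumOf-concatMap f g []       = refl
  sumOf-concatMap f g (x ∷ xs) = trans (sumOf-++ f (g x) _) (∙-congˡ (sumOf-concatMap f g xs))

module AssignmentSum {c ℓ : Level} (M : CommutativeMonoid c ℓ) where
  open CommutativeMonoid M
  open ListSum M
  open import Relation.Binary.Reasoning.Setoid setoid

  sumOf-assignments-suc : ∀ n (W : Vec Bool (suc n) → Carrier) →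
    sumOf W (assignments (suc n))
      ≈ sumOf (W ∘ (false ∷_)) (assignments n) ∙ sumOf (W ∘ (true ∷_)) (assignments n)
  sumOf-assignments-suc n W =
    trans (sumOf-++ W (map (false ∷_) As) (map (true ∷_) As))
          (∙-cong (reflexive (sumOf-map W (false ∷_) As)) (reflexive (sumOf-map W (true ∷_) As)))
    where As = assignments n

  sumOf-complement : ∀ n (W : Vec Bool n → Carrier) →
                     sumOf W (assignments n) ≈ sumOf (W ∘ Vec.map not) (assignments n)
  sumOf-complement zero    W = refl
  sumOf-complement (suc n) W = begin
    sumOf W (assignments (suc n))
      ≈⟨ sumOf-assignments-suc n W ⟩
    sumOf (W ∘ (false ∷_)) As ∙ sumOf (W ∘ (true ∷_)) As
      ≈⟨ ∙-cong (sumOf-complement n (W ∘ (false ∷_))) (sumOf-complement n (W ∘ (true ∷_))) ⟩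
    sumOf (λ τ → W (false ∷ Vec.map not τ)) As ∙ sumOf (λ τ → W (true ∷ Vec.map not τ)) As
      ≈⟨ comm _ _ ⟩
    sumOf (λ τ → W (true ∷ Vec.map not τ)) As ∙ sumOf (λ τ → W (false ∷ Vec.map not τ)) As
      ≈⟨ sumOf-assignments-suc n (W ∘ Vec.map not) ⟨
    sumOf (W ∘ Vec.map not) (assignments (suc n)) ∎
    where As = assignments n

  sumOf-complementary-pairs : ∀ n (W : Vec Bool (suc n) → Carrier) →
    sumOf W (assignments (suc n))
      ≈ sumOf (λ τ → W (false ∷ τ) ∙ W (true ∷ Vec.map not τ)) (assignments n)
  sumOf-complementary-pairs n W = begin
    sumOf W (assignments (suc n))
      ≈⟨ sumOf-assignments-suc n W ⟩
    sumOf (W ∘ (false ∷_)) As ∙ sumOf (W ∘ (true ∷_)) As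
      ≈⟨ ∙-congˡ (sumOf-complement n (W ∘ (true ∷_))) ⟩
    sumOf (W ∘ (false ∷_)) As ∙ sumOf (λ τ → W (true ∷ Vec.map not τ)) As
      ≈⟨ sumOf-∙ (W ∘ (false ∷_)) (λ τ → W (true ∷ Vec.map not τ)) As ⟨
    sumOf (λ τ → W (false ∷ τ) ∙ W (true ∷ Vec.map not τ)) As ∎
    where As = assignments n

module ℕSum where
  open ListSum +-0-commutativeMonoid public
  open Nat using (_+_; _*_)
  open import Data.Nat.Properties using (*-distribˡ-+; *-zeroʳ)
  open ≡ using (refl; cong)

  sumOf-filter : ∀ (p : A → Bool) f xs → sumOf f (filterᵇ p xs) ≡ sumOf (λ x → if p x then f x else 0) xs
  sumOf-filter p f []       = refl
  sumOf-filter p f (x ∷ xs) with p x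
  ... | true  = cong (f x +_) (sumOf-filter p f xs)
  ... | false = sumOf-filter p f xs

  sumOf-const : ∀ c (xs : List A) → sumOf (λ _ → c) xs ≡ length xs * c
  sumOf-const c []       = refl
  sumOf-const c (x ∷ xs) = cong (c +_) (sumOf-const c xs)

  sumOf-*ˡ : ∀ c (f : A → ℕ) xs → sumOf (λ x → c * f x) xs ≡ c * sumOf f xs
  sumOf-*ˡ c f []       = ≡.sym (*-zeroʳ c)
  sumOf-*ˡ c f (x ∷ xs) = ≡.trans (cong (c * f x +_) (sumOf-*ˡ c f xs)) (≡.sym (*-distribˡ-+ c (f x) _))

module Counting where
  open ℕSum
  open Nat using (_+_; _*_; _∸_; _≤_; _<ᵇ_)
  open import Data.Nat.Properties
    using ( +-identityʳ; +-comm; +-cancelʳ-≡; m+[n∸m]≡n; *-comm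
          ; ≤-total; <-asym; ≮⇒≥; ≤-antisym; <ᵇ-reflects-<)
  open ≡ using (refl; cong; cong₂)


  if-+ : ∀ b (x y : ℕ) → (if b then x + y else 0) ≡ (if b then x else 0) + (if b then y else 0)
  if-+ true  x y = refl
  if-+ false x y = refl

  module _ {n : ℕ} (G : Graph n) where

    ascendingAdj : Fin n → Fin n → Bool
    ascendingAdj u v = (toℕ u <ᵇ toℕ v) ∧ adj G u v

    if-adj-split : ∀ u v x → (if adj G u v then x else 0)
                           ≡ (if ascendingAdj u v then x else 0) + (if ascendingAdj v u then x else 0)
    if-adj-split u v x with toℕ u <ᵇ toℕ v | <ᵇ-reflects-< (toℕ u) (toℕ v)
                          | toℕ v <ᵇ toℕ u | <ᵇ-reflects-< (toℕ v) (toℕ u)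
    ... | true  | ofʸ u<v | true  | ofʸ v<u = ⊥-elim (<-asym u<v v<u)
    ... | true  | _       | false | _       = ≡.sym (+-identityʳ _)
    ... | false | _       | true  | _       rewrite Graph.sym G u v = refl
    ... | false | ofⁿ u≮v | false | ofⁿ v≮u
      rewrite toℕ-injective (≤-antisym (≮⇒≥ v≮u) (≮⇒≥ u≮v)) | irrefl G v = refl

    private
      Vs : List (Fin n)
      Vs = allFin n

      onEdge : Fin n → Fin n → ℕ → ℕ
      onEdge u v x = if ascendingAdj u v then x else 0

    sumOf-edges : ∀ (k : Fin n × Fin n → ℕ) →
                  sumOf k (edges G) ≡ sumOf (λ u → sumOf (λ v → onEdge u v (k (u , v))) Vs) Vs
    sumOf-edges k = ≡.trans (sumOf-concatMap k _ Vs) (sumOf-cong fromNeighbours Vs)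
      where
      fromNeighbours : ∀ u → sumOf k (map (u ,_) (filterᵇ (ascendingAdj u) Vs))
                           ≡ sumOf (λ v → onEdge u v (k (u , v))) Vs
      fromNeighbours u = ≡.trans (sumOf-map k (u ,_) (filterᵇ (ascendingAdj u) Vs))
                                 (sumOf-filter (ascendingAdj u) (λ v → k (u , v)) Vs)

    handshake : ∀ (c : Fin n → ℕ) →
                sumOf (λ u → degree G u * c u) Vs ≡ sumOf (λ e → c (proj₁ e) + c (proj₂ e)) (edges G)
    handshake c = begin
      sumOf (λ u → degree G u * c u) Vs
        ≡⟨ sumOf-cong (λ u → ≡.sym (sumOf-const (c u) (filterᵇ (adj G u) Vs))) Vs ⟩
      sumOf (λ u → sumOf (λ _ → c u) (filterᵇ (adj G u) Vs)) Vs
        ≡⟨ sumOf-cong (λ u → sumOf-filter (adj G u) (λ _ → c u) Vs) Vs ⟩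
      sumOf (λ u → sumOf (λ v → if adj G u v then c u else 0) Vs) Vs
        ≡⟨ sumOf-cong (λ u → ≡.trans (sumOf-cong (λ v → if-adj-split u v (c u)) Vs) (sumOf-∙ _ _ Vs)) Vs ⟩
      sumOf (λ u → sumOf (λ v → onEdge u v (c u)) Vs + sumOf (λ v → onEdge v u (c u)) Vs) Vs
        ≡⟨ sumOf-∙ _ _ Vs ⟩
      lowerEnds + sumOf (λ u → sumOf (λ v → onEdge v u (c u)) Vs) Vs
        ≡⟨ cong (lowerEnds +_) (sumOf-swap (λ u v → onEdge v u (c u)) Vs Vs) ⟩
      lowerEnds + sumOf (λ u → sumOf (λ v → onEdge u v (c v)) Vs) Vs
        ≡⟨ ≡.sym (sumOf-∙ _ _ Vs) ⟩
      sumOf (λ u → sumOf (λ v → onEdge u v (c u)) Vs + sumOf (λ v → onEdge u v (c v)) Vs) Vs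
        ≡⟨ sumOf-cong (λ u → ≡.sym (bothEnds u)) Vs ⟩
      sumOf (λ u → sumOf (λ v → onEdge u v (c u + c v)) Vs) Vs
        ≡⟨ ≡.sym (sumOf-edges (λ e → c (proj₁ e) + c (proj₂ e))) ⟩
      sumOf (λ e → c (proj₁ e) + c (proj₂ e)) (edges G) ∎
      where
      open ≡.≡-Reasoning
      lowerEnds : ℕ
      lowerEnds = sumOf (λ u → sumOf (λ v → onEdge u v (c u)) Vs) Vs
      bothEnds : ∀ u → sumOf (λ v → onEdge u v (c u + c v)) Vs
                     ≡ sumOf (λ v → onEdge u v (c u)) Vs + sumOf (λ v → onEdge u v (c v)) Vs
      bothEnds u = ≡.trans (sumOf-cong (λ v → if-+ (ascendingAdj u v) (c u) (c v)) Vs) (sumOf-∙ _ _ Vs)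

    regular-handshake : ∀ {d} → (∀ v → degree G v ≡ d) → ∀ (c : Fin n → ℕ) →
                        d * sumOf c Vs ≡ sumOf (λ e → c (proj₁ e) + c (proj₂ e)) (edges G)
    regular-handshake {d} regular c = begin
      d * sumOf c Vs                      ≡⟨ ≡.sym (sumOf-*ˡ d c Vs) ⟩
      sumOf (λ u → d * c u) Vs            ≡⟨ sumOf-cong (λ u → cong (_* c u) (≡.sym (regular u))) Vs ⟩
      sumOf (λ u → degree G u * c u) Vs   ≡⟨ handshake c ⟩
      sumOf (λ e → c (proj₁ e) + c (proj₂ e)) (edges G) ∎
      where open ≡.≡-Reasoning

  colourIs : Bool → Bool → ℕ
  colourIs false false = 1
  colourIs true  true  = 1
  colourIs _     _     = 0

  colourIs-not : ∀ c x → colourIs c (not x) ≡ colourIs (not c) x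
  colourIs-not false false = refl
  colourIs-not false true  = refl
  colourIs-not true  false = refl
  colourIs-not true  true  = refl

  colourClassSize : ∀ {n} → Bool → Vec Bool n → ℕ
  colourClassSize {n} c σ = sumOf (λ u → colourIs c (lookup σ u)) (allFin n)

  monochromaticEdges : ∀ {n} → Graph n → Bool → Vec Bool n → ℕ
  monochromaticEdges G c σ =
    sumOf (λ e → colourIs c (lookup σ (proj₁ e)) * colourIs c (lookup σ (proj₂ e))) (edges G)

  monochromaticEdges-complement : ∀ {n} (G : Graph n) c σ →
                                  monochromaticEdges G c (Vec.map not σ) ≡ monochromaticEdges G (not c) σ
  monochromaticEdges-complement G c σ =
    sumOf-cong (λ e → cong₂ _*_ (flipped (proj₁ e)) (flipped (proj₂ e))) (edges G)
    where
    flipped : ∀ u → colourIs c (lookup (Vec.map not σ) u) ≡ colourIs (not c) (lookup σ u)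
    flipped u = ≡.trans (cong (colourIs c) (lookup-map u not σ)) (colourIs-not c (lookup σ u))

  edge-colour-balance : ∀ x y →
    colourIs false x + colourIs false y + 2 * (colourIs true x * colourIs true y)
      ≡ colourIs true x + colourIs true y + 2 * (colourIs false x * colourIs false y)
  edge-colour-balance false false = refl
  edge-colour-balance false true  = refl
  edge-colour-balance true  false = refl
  edge-colour-balance true  true  = refl

  monochromatic-balance : ∀ {n} (G : Graph n) → ThreeRegular G → ∀ σ →
    3 * colourClassSize false σ + 2 * monochromaticEdges G true σ
      ≡ 3 * colourClassSize true σ + 2 * monochromaticEdges G false σ
  monochromatic-balance G regular σ = begin
    3 * colourClassSize false σ + 2 * monochromaticEdges G true σ
      ≡⟨ countEdges false ⟩
    sumOf (λ e → edgeTerm false (lookup σ (proj₁ e)) (lookup σ (proj₂ e))) (edges G)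
      ≡⟨ sumOf-cong (λ e → edge-colour-balance (lookup σ (proj₁ e)) (lookup σ (proj₂ e))) (edges G) ⟩
    sumOf (λ e → edgeTerm true (lookup σ (proj₁ e)) (lookup σ (proj₂ e))) (edges G)
      ≡⟨ ≡.sym (countEdges true) ⟩
    3 * colourClassSize true σ + 2 * monochromaticEdges G false σ ∎
    where
    open ≡.≡-Reasoning
    edgeTerm : Bool → Bool → Bool → ℕ
    edgeTerm c x y = colourIs c x + colourIs c y + 2 * (colourIs (not c) x * colourIs (not c) y)
    countEdges : ∀ c → 3 * colourClassSize c σ + 2 * monochromaticEdges G (not c) σ
                     ≡ sumOf (λ e → edgeTerm c (lookup σ (proj₁ e)) (lookup σ (proj₂ e))) (edges G)
    countEdges c = ≡.trans (cong₂ _+_ (regular-handshake G regular (λ u → colourIs c (lookup σ u)))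
                                      (≡.sym (sumOf-*ˡ 2 _ (edges G))))
                           (≡.sym (sumOf-∙ _ _ (edges G)))

  3∣2*n⇒3∣n : ∀ {n} → 3 ∣ 2 * n → 3 ∣ n
  3∣2*n⇒3∣n {n} 3∣2n = ∣m+n∣m⇒∣n (≡.subst (3 ∣_) (+-comm n (2 * n)) (m∣m*n n)) 3∣2n

  CongruentMod3 : ℕ → ℕ → Set
  CongruentMod3 A B = (∃ λ j → A ≡ B + 3 * j) ⊎ (∃ λ j → B ≡ A + 3 * j)

  3p+2m≡3q+2n⇒n≡m+3j : ∀ {p q m n} → 3 * p + 2 * m ≡ 3 * q + 2 * n → m ≤ n → ∃ λ j → n ≡ m + 3 * j
  3p+2m≡3q+2n⇒n≡m+3j {p} {q} {m} {n} eq m≤n = quotient , (begin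
      n                ≡⟨ m+[n∸m]≡n m≤n ⟨
      m + d            ≡⟨ cong (m +_) (≡.trans equality (*-comm quotient 3)) ⟩
      m + 3 * quotient ∎)
    where
    open ≡.≡-Reasoning
    d = n ∸ m
    regroup : ∀ q m d → 3 * q + 2 * (m + d) ≡ 3 * q + 2 * d + 2 * m
    regroup = solve-∀
    3p≡3q+2d : 3 * p ≡ 3 * q + 2 * d
    3p≡3q+2d = +-cancelʳ-≡ (2 * m) _ _ (begin
      3 * p + 2 * m         ≡⟨ eq ⟩
      3 * q + 2 * n         ≡⟨ cong (λ z → 3 * q + 2 * z) (m+[n∸m]≡n m≤n) ⟨
      3 * q + 2 * (m + d)   ≡⟨ regroup q m d ⟩
      3 * q + 2 * d + 2 * m ∎)
    open _∣_ (3∣2*n⇒3∣n {d} (∣m+n∣m⇒∣n (≡.subst (3 ∣_) 3p≡3q+2d (m∣m*n p)) (m∣m*n q)))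

  3p+2m≡3q+2n⇒CongruentMod3 : ∀ {p q m n} → 3 * p + 2 * m ≡ 3 * q + 2 * n → CongruentMod3 n m
  3p+2m≡3q+2n⇒CongruentMod3 {p} {q} {m} {n} eq with ≤-total m n
  ... | inj₁ m≤n = inj₁ (3p+2m≡3q+2n⇒n≡m+3j {p} {q} eq m≤n)
  ... | inj₂ n≤m = inj₂ (3p+2m≡3q+2n⇒n≡m+3j {q} {p} (≡.sym eq) n≤m)

  monochromaticEdges-congruent-mod-3 : ∀ {n} (G : Graph n) → ThreeRegular G → ∀ σ →
    CongruentMod3 (monochromaticEdges G false σ) (monochromaticEdges G true σ)
  monochromaticEdges-congruent-mod-3 G regular σ =
    3p+2m≡3q+2n⇒CongruentMod3 {colourClassSize false σ} {colourClassSize true σ}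
                              (monochromatic-balance G regular σ)

module Polynomials where
  open Nat using (_+_; _*_; _⊓_; ∣_-_∣)
  open import Data.Nat.Properties using (⊓-comm; ∣-∣-comm; ∣m-m+n∣≡n; m≥n⇒m⊓n≡n; m≤m+n; *-comm)
  open ≡ using (cong; cong₂)

  mulMonomial : ℕ → ℕ → Poly → Poly
  mulMonomial k l = map (λ (c , i , j) → (c , k + i , l + j))

  negatePoly : Poly → Poly
  negatePoly = map (λ (c , i , j) → (ℤ.- c , i , j))

  powerSumPoly : ℕ → Poly
  powerSumPoly zero          = [ (ℤ.+ 2 , 0 , 0) ]
  powerSumPoly (suc zero)    = [ (ℤ.+ 1 , 0 , 1) ]
  powerSumPoly (suc (suc j)) =
    mulMonomial 0 1 (powerSumPoly (suc j)) ++ negatePoly (mulMonomial 3 0 (powerSumPoly j))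

  -- Only meaningful when 3 divides ∣ A - B ∣; the division truncates otherwise.
  pairPoly : ℕ → ℕ → Poly
  pairPoly A B = mulMonomial (A ⊓ B) 0 (powerSumPoly (∣ A - B ∣ / 3))

  pairPoly-comm : ∀ A B → pairPoly A B ≡ pairPoly B A
  pairPoly-comm A B = cong₂ (λ k i → mulMonomial k 0 (powerSumPoly (i / 3))) (⊓-comm A B) (∣-∣-comm A B)

  pairPoly-apart : ∀ B j → pairPoly (B + 3 * j) B ≡ mulMonomial B 0 (powerSumPoly j)
  pairPoly-apart B j =
    cong₂ (λ k i → mulMonomial k 0 (powerSumPoly i)) (m≥n⇒m⊓n≡n (m≤m+n B (3 * j))) gap/3≡j
    where
    open ≡.≡-Reasoning
    gap/3≡j : ∣ B + 3 * j - B ∣ / 3 ≡ j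
    gap/3≡j = begin
      ∣ B + 3 * j - B ∣ / 3 ≡⟨ cong (_/ 3) (∣-∣-comm (B + 3 * j) B) ⟩
      ∣ B - B + 3 * j ∣ / 3 ≡⟨ cong (_/ 3) (∣m-m+n∣≡n B (3 * j)) ⟩
      3 * j / 3             ≡⟨ cong (_/ 3) (*-comm 3 j) ⟩
      j * 3 / 3             ≡⟨ m*n/n≡m j 3 ⟩
      j                     ∎

open Counting
open Polynomials

-- τ stands for the complementary pair of assignments false ∷ τ and true ∷ map not τ.
partitionPoly : ∀ {n} → Graph n → Poly
partitionPoly {zero}  G = [ (ℤ.+ 1 , 0 , 0) ]
partitionPoly {suc n} G = concatMap (λ τ → pairPoly (monochromaticEdges G false (false ∷ τ))
                                                    (monochromaticEdges G true  (false ∷ τ)))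
                                    (assignments n)

module _ {c ℓ : Level} (R : CommutativeRing c ℓ) where
  open CommutativeRing R
  open import Algebra.Properties.CommutativeSemiring.Exp commutativeSemiring
    using (_^_; ^-homo-*; ^-assocʳ; ^-distrib-*)
  open import Algebra.Properties.Ring ring using (-‿distribˡ-*)
  open import Algebra.Properties.AbelianGroup +-abelianGroup using (⁻¹-∙-comm; ⁻¹-involutive; ε⁻¹≈ε)
  open import Algebra.Properties.Group +-group using (//-rightDividesʳ)
  open import Algebra.Solver.Ring.NaturalCoefficients.Default commutativeSemiring
  open import Relation.Binary.Reasoning.Setoid setoid
  open ListSum +-commutativeMonoid using (sumOf; sumOf-cong)
  open AssignmentSum +-commutativeMonoid using (sumOf-complementary-pairs)
  open ListSum *-commutativeMonoid using ()
    renaming (sumOf to productOf; sumOf-cong to productOf-cong; sumOf-∙ to productOf-*)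

  pow≡^ : ∀ x k → pow R x k ≡ x ^ k
  pow≡^ x zero    = ≡.refl
  pow≡^ x (suc k) = ≡.cong (x *_) (pow≡^ x k)

  evalPoly-++ : ∀ P Q x y → evalPoly R (P ++ Q) x y ≈ evalPoly R P x y + evalPoly R Q x y
  evalPoly-++ []                Q x y = sym (+-identityˡ _)
  evalPoly-++ ((c , i , j) ∷ P) Q x y = trans (+-congˡ (evalPoly-++ P Q x y)) (sym (+-assoc _ _ _))

  evalPoly-mulMonomial : ∀ k l P x y →
    evalPoly R (mulMonomial k l P) x y ≈ (x ^ k * y ^ l) * evalPoly R P x y
  evalPoly-mulMonomial k l []                x y = sym (zeroʳ _)
  evalPoly-mulMonomial k l ((c , i , j) ∷ P) x y
    rewrite pow≡^ x (k Nat.+ i) | pow≡^ y (l Nat.+ j) | pow≡^ x i | pow≡^ y j = begin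
      intR R c * x ^ (k Nat.+ i) * y ^ (l Nat.+ j) + evalPoly R (mulMonomial k l P) x y
        ≈⟨ +-cong (*-cong (*-congˡ (^-homo-* x k i)) (^-homo-* y l j)) (evalPoly-mulMonomial k l P x y) ⟩
      intR R c * (x ^ k * x ^ i) * (y ^ l * y ^ j) + (x ^ k * y ^ l) * evalPoly R P x y
        ≈⟨ solve 6 (λ C Xk Xi Yl Yj E → C :* (Xk :* Xi) :* (Yl :* Yj) :+ (Xk :* Yl) :* E
                                      := (Xk :* Yl) :* (C :* Xi :* Yj :+ E))
                 refl (intR R c) (x ^ k) (x ^ i) (y ^ l) (y ^ j) (evalPoly R P x y) ⟩
      (x ^ k * y ^ l) * (intR R c * x ^ i * y ^ j + evalPoly R P x y) ∎

  intR-neg : ∀ c → intR R (ℤ.- c) ≈ - intR R c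
  intR-neg (ℤ.+ zero)  = sym ε⁻¹≈ε
  intR-neg (ℤ.+ suc k) = refl
  intR-neg ℤ.-[1+ k ]  = sym (⁻¹-involutive _)

  evalPoly-negate : ∀ P x y → evalPoly R (negatePoly P) x y ≈ - evalPoly R P x y
  evalPoly-negate []                x y = sym ε⁻¹≈ε
  evalPoly-negate ((c , i , j) ∷ P) x y = begin
    intR R (ℤ.- c) * pow R x i * pow R y j + evalPoly R (negatePoly P) x y
      ≈⟨ +-cong (*-congʳ (*-congʳ (intR-neg c))) (evalPoly-negate P x y) ⟩
    - intR R c * pow R x i * pow R y j + - evalPoly R P x y
      ≈⟨ +-congʳ (trans (*-congʳ (sym (-‿distribˡ-* _ _))) (sym (-‿distribˡ-* _ _))) ⟩
    - (intR R c * pow R x i * pow R y j) + - evalPoly R P x y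
      ≈⟨ ⁻¹-∙-comm _ _ ⟩
    - (intR R c * pow R x i * pow R y j + evalPoly R P x y) ∎

  newton-step : ∀ u v j →
    (u + v) * (u ^ suc j + v ^ suc j) + - ((u * v) * (u ^ j + v ^ j)) ≈ u ^ suc (suc j) + v ^ suc (suc j)
  newton-step u v j = begin
    (u + v) * (u * U + v * V) + - ((u * v) * (U + V))
      ≈⟨ +-congʳ (solve 4 (λ u v U V → (u :+ v) :* (u :* U :+ v :* V)
                                      := u :* (u :* U) :+ v :* (v :* V) :+ (u :* v) :* (U :+ V))
                          refl u v U V) ⟩
    (u * (u * U) + v * (v * V)) + (u * v) * (U + V) + - ((u * v) * (U + V))
      ≈⟨ //-rightDividesʳ _ _ ⟩
    u * (u * U) + v * (v * V) ∎
    where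
    U = u ^ j
    V = v ^ j

  evalPoly-powerSumPoly : ∀ {x u v} → x ^ 3 ≈ u * v → ∀ j →
                          evalPoly R (powerSumPoly j) x (u + v) ≈ u ^ j + v ^ j
  evalPoly-powerSumPoly x³≈uv zero =
    solve 0 ((con 1 :+ (con 1 :+ con 0)) :* con 1 :* con 1 :+ con 0 := con 1 :+ con 1) refl
  evalPoly-powerSumPoly {u = u} {v} x³≈uv (suc zero) =
    solve 2 (λ u v → (con 1 :+ con 0) :* con 1 :* ((u :+ v) :* con 1) :+ con 0 := u :* con 1 :+ v :* con 1)
            refl u v
  evalPoly-powerSumPoly {x} {u} {v} x³≈uv (suc (suc j)) = begin
    evalPoly R (mulMonomial 0 1 P₁ ++ negatePoly (mulMonomial 3 0 P₀)) x y
      ≈⟨ evalPoly-++ (mulMonomial 0 1 P₁) _ x y ⟩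
    evalPoly R (mulMonomial 0 1 P₁) x y + evalPoly R (negatePoly (mulMonomial 3 0 P₀)) x y
      ≈⟨ +-cong (evalPoly-mulMonomial 0 1 P₁ x y)
                (trans (evalPoly-negate (mulMonomial 3 0 P₀) x y) (-‿cong (evalPoly-mulMonomial 3 0 P₀ x y))) ⟩
    (1# * (y * 1#)) * evalPoly R P₁ x y + - ((x ^ 3 * 1#) * evalPoly R P₀ x y)
      ≈⟨ +-cong (*-cong (trans (*-identityˡ _) (*-identityʳ y)) (evalPoly-powerSumPoly x³≈uv (suc j)))
                (-‿cong (*-cong (trans (*-identityʳ _) x³≈uv) (evalPoly-powerSumPoly x³≈uv j))) ⟩
    y * (u ^ suc j + v ^ suc j) + - ((u * v) * (u ^ j + v ^ j))
      ≈⟨ newton-step u v j ⟩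
    u ^ suc (suc j) + v ^ suc (suc j) ∎
    where
    y = u + v
    P₀ = powerSumPoly j
    P₁ = powerSumPoly (suc j)

  evalPoly-pairPoly-apart : ∀ a b B j →
    evalPoly R (pairPoly (B Nat.+ 3 Nat.* j) B) (a * b) (a ^ 3 + b ^ 3)
      ≈ a ^ (B Nat.+ 3 Nat.* j) * b ^ B + a ^ B * b ^ (B Nat.+ 3 Nat.* j)
  evalPoly-pairPoly-apart a b B j = begin
    evalPoly R (pairPoly (B Nat.+ 3 Nat.* j) B) (a * b) (a ^ 3 + b ^ 3)
      ≡⟨ ≡.cong (λ P → evalPoly R P (a * b) (a ^ 3 + b ^ 3)) (pairPoly-apart B j) ⟩
    evalPoly R (mulMonomial B 0 (powerSumPoly j)) (a * b) (a ^ 3 + b ^ 3)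
      ≈⟨ evalPoly-mulMonomial B 0 (powerSumPoly j) (a * b) _ ⟩
    ((a * b) ^ B * 1#) * evalPoly R (powerSumPoly j) (a * b) (a ^ 3 + b ^ 3)
      ≈⟨ *-cong (trans (*-identityʳ _) (^-distrib-* a b B)) (evalPoly-powerSumPoly (^-distrib-* a b 3) j) ⟩
    (a ^ B * b ^ B) * ((a ^ 3) ^ j + (b ^ 3) ^ j)
      ≈⟨ *-congˡ (+-cong (^-assocʳ a 3 j) (^-assocʳ b 3 j)) ⟩
    (a ^ B * b ^ B) * (a ^ (3 Nat.* j) + b ^ (3 Nat.* j))
      ≈⟨ solve 4 (λ Aᴮ Bᴮ A³ʲ B³ʲ → (Aᴮ :* Bᴮ) :* (A³ʲ :+ B³ʲ) := (Aᴮ :* A³ʲ) :* Bᴮ :+ Aᴮ :* (Bᴮ :* B³ʲ))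
               refl (a ^ B) (b ^ B) (a ^ (3 Nat.* j)) (b ^ (3 Nat.* j)) ⟩
    (a ^ B * a ^ (3 Nat.* j)) * b ^ B + a ^ B * (b ^ B * b ^ (3 Nat.* j))
      ≈⟨ +-cong (*-congʳ (^-homo-* a B _)) (*-congˡ (^-homo-* b B _)) ⟨
    a ^ (B Nat.+ 3 Nat.* j) * b ^ B + a ^ B * b ^ (B Nat.+ 3 Nat.* j) ∎

  evalPoly-pairPoly : ∀ a b A B → CongruentMod3 A B →
    evalPoly R (pairPoly A B) (a * b) (a ^ 3 + b ^ 3) ≈ a ^ A * b ^ B + a ^ B * b ^ A
  evalPoly-pairPoly a b _ B (inj₁ (j , ≡.refl)) = evalPoly-pairPoly-apart a b B j
  evalPoly-pairPoly a b A _ (inj₂ (j , ≡.refl))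
    rewrite pairPoly-comm A (A Nat.+ 3 Nat.* j) = trans (evalPoly-pairPoly-apart a b A j) (+-comm _ _)

  evalPoly-concatMap : ∀ (F : A → Poly) xs x y →
                       evalPoly R (concatMap F xs) x y ≈ sumOf (λ t → evalPoly R (F t) x y) xs
  evalPoly-concatMap F []       x y = refl
  evalPoly-concatMap F (t ∷ xs) x y =
    trans (evalPoly-++ (F t) _ x y) (+-congˡ (evalPoly-concatMap F xs x y))

  g≈powers : ∀ a b x y →
    g R a b x y ≈ a ^ (colourIs false x Nat.* colourIs false y) * b ^ (colourIs true x Nat.* colourIs true y)
  g≈powers a b false false = sym (trans (*-identityʳ _) (*-identityʳ a))
  g≈powers a b false true  = sym (*-identityʳ 1#)
  g≈powers a b true  false = sym (*-identityʳ 1#)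
  g≈powers a b true  true  = sym (trans (*-identityˡ _) (*-identityʳ b))

  productOf-^ : ∀ x (f : A → ℕ) xs → productOf (λ t → x ^ f t) xs ≈ x ^ ℕSum.sumOf f xs
  productOf-^ x f []       = refl
  productOf-^ x f (t ∷ xs) = trans (*-congˡ (productOf-^ x f xs)) (sym (^-homo-* x (f t) _))

  partitionFn≈sumOf-powers : ∀ {n} (G : Graph n) a b →
    partitionFn R G a b
      ≈ sumOf (λ σ → a ^ monochromaticEdges G false σ * b ^ monochromaticEdges G true σ) (assignments n)
  partitionFn≈sumOf-powers G a b =
    sumOf-cong (λ σ → trans (productOf-cong (λ (u , v) → g≈powers a b (lookup σ u) (lookup σ v)) (edges G))
                            (edgeProduct σ))
               (assignments _)
    where
    edgeProduct : ∀ σ →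
      productOf (λ e → a ^ (colourIs false (lookup σ (proj₁ e)) Nat.* colourIs false (lookup σ (proj₂ e)))
                     * b ^ (colourIs true  (lookup σ (proj₁ e)) Nat.* colourIs true  (lookup σ (proj₂ e))))
                (edges G)
        ≈ a ^ monochromaticEdges G false σ * b ^ monochromaticEdges G true σ
    edgeProduct σ =
      trans (productOf-* _ _ (edges G)) (*-cong (productOf-^ a _ (edges G)) (productOf-^ b _ (edges G)))

  partitionFn≈evalPoly : ∀ {n} (G : Graph n) → ThreeRegular G → ∀ a b →
                         partitionFn R G a b ≈ evalPoly R (partitionPoly G) (a * b) (a ^ 3 + b ^ 3)
  partitionFn≈evalPoly {zero}  G _       a b =
    +-congʳ (sym (trans (*-identityʳ _) (trans (*-identityʳ _) (+-identityʳ 1#))))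
  partitionFn≈evalPoly {suc n} G regular a b = begin
    partitionFn R G a b
      ≈⟨ partitionFn≈sumOf-powers G a b ⟩
    sumOf weight (assignments (suc n))
      ≈⟨ sumOf-complementary-pairs n weight ⟩
    sumOf (λ τ → weight (false ∷ τ) + weight (Vec.map not (false ∷ τ))) (assignments n)
      ≈⟨ sumOf-cong (λ τ → +-congˡ (reflexive (≡.cong₂ (λ i k → a ^ i * b ^ k)
                      (monochromaticEdges-complement G false (false ∷ τ))
                      (monochromaticEdges-complement G true (false ∷ τ))))) (assignments n) ⟩
    sumOf (λ τ → a ^ m₀ τ * b ^ m₁ τ + a ^ m₁ τ * b ^ m₀ τ) (assignments n)
      ≈⟨ sumOf-cong (λ τ → evalPoly-pairPoly a b (m₀ τ) (m₁ τ)
                      (monochromaticEdges-congruent-mod-3 G regular (false ∷ τ))) (assignments n) ⟨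
    sumOf (λ τ → evalPoly R (pairPoly (m₀ τ) (m₁ τ)) (a * b) (a ^ 3 + b ^ 3)) (assignments n)
      ≈⟨ evalPoly-concatMap (λ τ → pairPoly (m₀ τ) (m₁ τ)) (assignments n) (a * b) (a ^ 3 + b ^ 3) ⟨
    evalPoly R (partitionPoly G) (a * b) (a ^ 3 + b ^ 3) ∎
    where
    weight : Vec Bool (suc n) → Carrier
    weight σ = a ^ monochromaticEdges G false σ * b ^ monochromaticEdges G true σ
    m₀ m₁ : Vec Bool n → ℕ
    m₀ τ = monochromaticEdges G false (false ∷ τ)
    m₁ τ = monochromaticEdges G true  (false ∷ τ)

lemma4p1 : {c ℓ : Level} (n : ℕ) (G : Graph n) → ThreeRegular G →
  ∃ λ (P : Poly) → (R : CommutativeRing c ℓ) → (a b : CommutativeRing.Carrier R) →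
    CommutativeRing._≈_ R (partitionFn R G a b)
      (evalPoly R P (CommutativeRing._*_ R a b)
        (CommutativeRing._+_ R (pow R a 3) (pow R b 3)))
lemma4p1 n G regular = partitionPoly G , λ R a b → partitionFn≈evalPoly R G regular a b
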